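{- Let $X$ be a set with $|X|=6$. Then there exist $\alpha,\beta\in\mathcal{P}(X)\setminus\{\emptyset,\mathrm{id}_X\}$ such that the distance between $\alpha$ and $\beta$ in the commuting graph $\mathcal{G}(\mathcal{P}(X))$ is at least $5$.
   Context: $\mathcal{P}(X)$ is the partial transformation semigroup on $X$: all functions whose domain and image are subsets of $X$ (including the empty map $\emptyset$), with composition as multiplication (maps act on the right). Its center is $\{\emptyset,\mathrm{id}_X\}$. For a finite non-commutative semigroup $S$, the commuting graph $\mathcal{G}(S)$ is the simple graph with vertex set $S\setminus Z(S)$ ($Z(S)$ the center), two distinct vertices $x,y$ being adjacent iff $xy=yx$. The distance between two vertices is the length of a shortest path between them ($\infty$ if none). -}

module Defs where

open import Data.Nat using (ℕ; zero; suc)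
open import Data.Fin using (Fin)
open import Data.Maybe using (Maybe; just; nothing; _>>=_)
open import Data.Vec using (Vec; lookup; tabulate; replicate)
open import Relation.Binary.PropositionalEquality using (_≡_; _≢_)
open import Relation.Nullary using (¬_)
open import Data.Product using (_×_)

-- A partial transformation of X = Fin n: the image of each point, or nothing
-- if the point is outside the domain.  Vec gives extensional equality via _≡_.
PT : ℕ → Set
PT n = Vec (Maybe (Fin n)) n

-- Composition with maps acting on the right: x (α · β) = (x α) β.
_·_ : ∀ {n} → PT n → PT n → PT n
α · β = tabulate (λ i → lookup α i >>= lookup β)

emptyPT : ∀ {n} → PT n
emptyPT = replicate _ nothing

idPT : ∀ {n} → PT n
idPT = tabulate just

InCenter : ∀ {n} → PT n → Set
InCenter {n} z = (s : PT n) → z · s ≡ s · z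

IsVertex : ∀ {n} → PT n → Set
IsVertex z = ¬ InCenter z

Adjacent : ∀ {n} → PT n → PT n → Set
Adjacent x y = IsVertex x × IsVertex y × x ≢ y × x · y ≡ y · x

data Walk {n : ℕ} : ℕ → PT n → PT n → Set where
  here : ∀ {x} → IsVertex x → Walk zero x x
  step : ∀ {k x y z} → Adjacent x y → Walk k y z → Walk (suc k) x z

-- dist(x,y) ≥ d  (including dist = ∞): every walk from x to y has length ≥ d.
DistAtLeast : ∀ {n} → ℕ → PT n → PT n → Set
DistAtLeast {n} d x y = ∀ {k} → Walk {n} k x y → d Data.Nat.≤ k

-- Take α₀ : 5 ↦ 4 ↦ 3 ↦ 0 ↦ 1 ↦ 2 ↦ 0, a tail running into a 3-cycle, and the 6-cycle
-- β₀ = (0 1 3 4 2 5).  The non-central elements commuting with α₀ are α₀, …, α₀⁵, all with cube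
-- the idempotent α₀³; those commuting with β₀ are β₀, …, β₀⁵, each generating a subgroup that
-- contains β₀² or β₀³.  Only ∅ and id commute with α₀³ and with β₀² or β₀³, so no vertex
-- commutes with both a neighbour of α₀ and a neighbour of β₀, which the middle vertex of a path
-- of length at most 4 from α₀ to β₀ would do.
module Submission where

open import Defs
open import Data.Nat using (ℕ; zero; suc; s≤s; z≤n)
open import Data.Fin using (Fin; zero; suc)
open import Data.Maybe using (just; nothing; _>>=_)
open import Data.Vec using ([]; _∷_; lookup)
open import Data.Vec.Properties using (lookup∘tabulate; tabulate∘lookup; tabulate-cong; lookup-replicate)
open import Data.Product using (Σ; _×_; _,_)
open import Data.Sum using (_⊎_; inj₁; inj₂)
open import Data.Empty using (⊥; ⊥-elim)
open import Relation.Binary.PropositionalEquality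
  using (_≡_; _≢_; refl; sym; trans; cong; cong₂; subst; module ≡-Reasoning)

·-assoc : ∀ {n} (x y z : PT n) → (x · y) · z ≡ x · (y · z)
·-assoc x y z = tabulate-cong pointwise
  where
  pointwise : ∀ i → (lookup (x · y) i >>= lookup z) ≡ (lookup x i >>= lookup (y · z))
  pointwise i rewrite lookup∘tabulate (λ k → lookup x k >>= lookup y) i with lookup x i
  ... | nothing = refl
  ... | just j  = sym (lookup∘tabulate (λ k → lookup y k >>= lookup z) j)

·-identityˡ : ∀ {n} (x : PT n) → idPT · x ≡ x
·-identityˡ x = trans (tabulate-cong (λ i → cong (_>>= lookup x) (lookup∘tabulate just i)))
                      (tabulate∘lookup x)

·-identityʳ : ∀ {n} (x : PT n) → x · idPT ≡ x
·-identityʳ x = trans (tabulate-cong pointwise) (tabulate∘lookup x)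
  where
  pointwise : ∀ i → (lookup x i >>= lookup idPT) ≡ lookup x i
  pointwise i with lookup x i
  ... | nothing = refl
  ... | just j  = lookup∘tabulate just j

·-zeroˡ : ∀ {n} (x : PT n) → emptyPT · x ≡ emptyPT
·-zeroˡ {n} x = trans (tabulate-cong pointwise) (tabulate∘lookup (emptyPT {n}))
  where
  pointwise : ∀ i → (lookup (emptyPT {n}) i >>= lookup x) ≡ lookup (emptyPT {n}) i
  pointwise i rewrite lookup-replicate i (nothing {A = Fin n}) = refl

·-zeroʳ : ∀ {n} (x : PT n) → x · emptyPT ≡ emptyPT
·-zeroʳ {n} x = trans (tabulate-cong pointwise) (tabulate∘lookup (emptyPT {n}))
  where
  pointwise : ∀ i → (lookup x i >>= lookup (emptyPT {n})) ≡ lookup (emptyPT {n}) i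
  pointwise i with lookup x i
  ... | nothing = sym (lookup-replicate i nothing)
  ... | just j  = trans (lookup-replicate j nothing) (sym (lookup-replicate i nothing))

idPT-central : ∀ {n} → InCenter {n} idPT
idPT-central x = trans (·-identityˡ x) (sym (·-identityʳ x))

emptyPT-central : ∀ {n} → InCenter {n} emptyPT
emptyPT-central x = trans (·-zeroˡ x) (sym (·-zeroʳ x))

record Commute {n} (x y : PT n) : Set where
  constructor commuting
  field commutes : x · y ≡ y · x

open Commute

commute-refl : ∀ {n} {x : PT n} → Commute x x
commute-refl = commuting refl

commute-· : ∀ {n} {x a b : PT n} → Commute x a → Commute x b → Commute x (a · b)
commute-· {x = x} {a} {b} (commuting xa) (commuting xb) = commuting (begin
  x · (a · b)  ≡⟨ sym (·-assoc x a b) ⟩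
  (x · a) · b  ≡⟨ cong (_· b) xa ⟩
  (a · x) · b  ≡⟨ ·-assoc a x b ⟩
  a · (x · b)  ≡⟨ cong (a ·_) xb ⟩
  a · (b · x)  ≡⟨ sym (·-assoc a b x) ⟩
  (a · b) · x  ∎)
  where open ≡-Reasoning

_^_ : ∀ {n} → PT n → ℕ → PT n
x ^ zero  = idPT
x ^ suc k = x · (x ^ k)

commute-^ : ∀ {n} {x a : PT n} → Commute x a → ∀ k → Commute x (a ^ k)
commute-^ {x = x} xa zero    = commuting (sym (idPT-central x))
commute-^         xa (suc k) = commute-· xa (commute-^ xa k)

Near : ∀ {n} → PT n → PT n → Set
Near v u = IsVertex u × Commute u v

near-self : ∀ {n} {v : PT n} → IsVertex v → Near v v
near-self iv = iv , commute-refl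

Apart : ∀ {n} → PT n → PT n → Set
Apart α β = ∀ x u w → IsVertex x → Near α u → Near β w → Commute x u → Commute x w → ⊥

-- A walk of length at most 4 has a vertex within distance 2 of both ends.
apart⇒distAtLeast5 : ∀ {n} {α β : PT n} → Apart α β → DistAtLeast 5 α β
apart⇒distAtLeast5 {α = α} apart (here iα) =
  ⊥-elim (apart α α α iα (near-self iα) (near-self iα) commute-refl commute-refl)
apart⇒distAtLeast5 {α = α} {β} apart (step (iα , iβ , _ , αβ) (here _)) =
  ⊥-elim (apart α α β iα (near-self iα) (near-self iβ) commute-refl (commuting αβ))
apart⇒distAtLeast5 {α = α} {β} apart
  (step {y = y} (iα , iy , _ , αy) (step (_ , iβ , _ , yβ) (here _))) =
  ⊥-elim (apart y α β iy (near-self iα) (near-self iβ) (commuting (sym αy)) (commuting yβ))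
apart⇒distAtLeast5 {α = α} apart
  (step {y = y} (iα , iy , _ , αy) (step {y = z} (_ , iz , _ , yz) (step (_ , _ , _ , zβ) (here _)))) =
  ⊥-elim (apart y α z iy (near-self iα) (iz , commuting zβ) (commuting (sym αy)) (commuting yz))
apart⇒distAtLeast5 apart
  (step {y = y} (_ , iy , _ , αy) (step {y = z} (_ , iz , _ , yz)
    (step {y = t} (_ , it , _ , zt) (step (_ , _ , _ , tβ) (here _))))) =
  ⊥-elim (apart z y t iz (iy , commuting (sym αy)) (it , commuting tβ) (commuting (sym yz)) (commuting zt))
apart⇒distAtLeast5 apart (step _ (step _ (step _ (step _ (step _ _))))) =
  s≤s (s≤s (s≤s (s≤s (s≤s z≤n))))

pattern ⓪ = just zero
pattern ① = just (suc zero)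
pattern ② = just (suc (suc zero))
pattern ③ = just (suc (suc (suc zero)))
pattern ④ = just (suc (suc (suc (suc zero))))
pattern ⑤ = just (suc (suc (suc (suc (suc zero)))))

α₀ : PT 6
α₀ = ① ∷ ② ∷ ⓪ ∷ ⓪ ∷ ③ ∷ ④ ∷ []

β₀ : PT 6
β₀ = ① ∷ ③ ∷ ⑤ ∷ ④ ∷ ② ∷ ⓪ ∷ []

-- The image of 5 determines u, since every point lies on the α₀-path from 5.
cube-of-commuting-with-α₀ : ∀ u → IsVertex u → Commute u α₀ → u ^ 3 ≡ α₀ ^ 3
cube-of-commuting-with-α₀ (_ ∷ _ ∷ _ ∷ _ ∷ _ ∷ nothing ∷ []) iu (commuting refl) = ⊥-elim (iu emptyPT-central)
cube-of-commuting-with-α₀ (_ ∷ _ ∷ _ ∷ _ ∷ _ ∷ ⓪ ∷ []) _ (commuting refl) = refl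
cube-of-commuting-with-α₀ (_ ∷ _ ∷ _ ∷ _ ∷ _ ∷ ① ∷ []) _ (commuting refl) = refl
cube-of-commuting-with-α₀ (_ ∷ _ ∷ _ ∷ _ ∷ _ ∷ ② ∷ []) _ (commuting refl) = refl
cube-of-commuting-with-α₀ (_ ∷ _ ∷ _ ∷ _ ∷ _ ∷ ③ ∷ []) _ (commuting refl) = refl
cube-of-commuting-with-α₀ (_ ∷ _ ∷ _ ∷ _ ∷ _ ∷ ④ ∷ []) _ (commuting refl) = refl
cube-of-commuting-with-α₀ (_ ∷ _ ∷ _ ∷ _ ∷ _ ∷ ⑤ ∷ []) iu (commuting refl) = ⊥-elim (iu idPT-central)

-- The clauses are w = β₀ᵏ for k = 1, …, 5; ⟨w⟩ contains β₀² (k ≠ 3) or β₀³ (k = 3).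
commute-with-commuting-with-β₀ : ∀ {x} w → IsVertex w → Commute w β₀ → Commute x w →
                                 Commute x (β₀ ^ 2) ⊎ Commute x (β₀ ^ 3)
commute-with-commuting-with-β₀ (nothing ∷ _ ∷ _ ∷ _ ∷ _ ∷ _ ∷ []) iw (commuting refl) _ = ⊥-elim (iw emptyPT-central)
commute-with-commuting-with-β₀ (⓪ ∷ _ ∷ _ ∷ _ ∷ _ ∷ _ ∷ []) iw (commuting refl) _ = ⊥-elim (iw idPT-central)
commute-with-commuting-with-β₀ (① ∷ _ ∷ _ ∷ _ ∷ _ ∷ _ ∷ []) _ (commuting refl) xw = inj₁ (commute-^ xw 2)
commute-with-commuting-with-β₀ (③ ∷ _ ∷ _ ∷ _ ∷ _ ∷ _ ∷ []) _ (commuting refl) xw = inj₁ (commute-^ xw 1)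
commute-with-commuting-with-β₀ (④ ∷ _ ∷ _ ∷ _ ∷ _ ∷ _ ∷ []) _ (commuting refl) xw = inj₂ (commute-^ xw 1)
commute-with-commuting-with-β₀ (② ∷ _ ∷ _ ∷ _ ∷ _ ∷ _ ∷ []) _ (commuting refl) xw = inj₁ (commute-^ xw 2)
commute-with-commuting-with-β₀ (⑤ ∷ _ ∷ _ ∷ _ ∷ _ ∷ _ ∷ []) _ (commuting refl) xw = inj₂ (commute-^ xw 3)

CommuteBoth : ∀ {n} → PT n → PT n → PT n → Set
CommuteBoth {n} x a b = _≡_ {A = PT n × PT n} (x · a , x · b) (a · x , b · x)

-- Every point is reached from point 1 under β₀² and α₀³, and from point 3 under β₀³ and α₀³,
-- so the image of that point determines x.
centralizer-β₀²-α₀³ : ∀ x → CommuteBoth x (β₀ ^ 2) (α₀ ^ 3) → x ≡ emptyPT ⊎ x ≡ idPT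
centralizer-β₀²-α₀³ (_ ∷ nothing ∷ _ ∷ _ ∷ _ ∷ _ ∷ []) refl = inj₁ refl
centralizer-β₀²-α₀³ (_ ∷ ⓪ ∷ _ ∷ _ ∷ _ ∷ _ ∷ []) ()
centralizer-β₀²-α₀³ (_ ∷ ① ∷ _ ∷ _ ∷ _ ∷ _ ∷ []) refl = inj₂ refl
centralizer-β₀²-α₀³ (_ ∷ ② ∷ _ ∷ _ ∷ _ ∷ _ ∷ []) ()
centralizer-β₀²-α₀³ (_ ∷ ③ ∷ _ ∷ _ ∷ _ ∷ _ ∷ []) ()
centralizer-β₀²-α₀³ (_ ∷ ④ ∷ _ ∷ _ ∷ _ ∷ _ ∷ []) ()
centralizer-β₀²-α₀³ (_ ∷ ⑤ ∷ _ ∷ _ ∷ _ ∷ _ ∷ []) ()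

centralizer-β₀³-α₀³ : ∀ x → CommuteBoth x (β₀ ^ 3) (α₀ ^ 3) → x ≡ emptyPT ⊎ x ≡ idPT
centralizer-β₀³-α₀³ (_ ∷ _ ∷ _ ∷ nothing ∷ _ ∷ _ ∷ []) refl = inj₁ refl
centralizer-β₀³-α₀³ (_ ∷ _ ∷ _ ∷ ⓪ ∷ _ ∷ _ ∷ []) ()
centralizer-β₀³-α₀³ (_ ∷ _ ∷ _ ∷ ① ∷ _ ∷ _ ∷ []) ()
centralizer-β₀³-α₀³ (_ ∷ _ ∷ _ ∷ ② ∷ _ ∷ _ ∷ []) ()
centralizer-β₀³-α₀³ (_ ∷ _ ∷ _ ∷ ③ ∷ _ ∷ _ ∷ []) refl = inj₂ refl
centralizer-β₀³-α₀³ (_ ∷ _ ∷ _ ∷ ④ ∷ _ ∷ _ ∷ []) ()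
centralizer-β₀³-α₀³ (_ ∷ _ ∷ _ ∷ ⑤ ∷ _ ∷ _ ∷ []) ()

centralizer-α₀³-β₀-power : ∀ {x} → Commute x (α₀ ^ 3) → Commute x (β₀ ^ 2) ⊎ Commute x (β₀ ^ 3) →
                           x ≡ emptyPT ⊎ x ≡ idPT
centralizer-α₀³-β₀-power {x} xα₀³ (inj₁ xβ₀²) = centralizer-β₀²-α₀³ x (cong₂ _,_ (commutes xβ₀²) (commutes xα₀³))
centralizer-α₀³-β₀-power {x} xα₀³ (inj₂ xβ₀³) = centralizer-β₀³-α₀³ x (cong₂ _,_ (commutes xβ₀³) (commutes xα₀³))

central-not-vertex : ∀ {n} {x : PT n} → IsVertex x → x ≡ emptyPT ⊎ x ≡ idPT → ⊥
central-not-vertex ix (inj₁ refl) = ix emptyPT-central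
central-not-vertex ix (inj₂ refl) = ix idPT-central

α₀-β₀-apart : Apart α₀ β₀
α₀-β₀-apart x u w ix (iu , uα₀) (iw , wβ₀) xu xw =
  central-not-vertex ix (centralizer-α₀³-β₀-power xα₀³ (commute-with-commuting-with-β₀ w iw wβ₀ xw))
  where
  xα₀³ : Commute x (α₀ ^ 3)
  xα₀³ = subst (Commute x) (cube-of-commuting-with-α₀ u iu uα₀) (commute-^ xu 3)

lemma3p12 : Σ (PT 6) λ α → Σ (PT 6) λ β →
    (α ≢ emptyPT × α ≢ idPT) × (β ≢ emptyPT × β ≢ idPT) × DistAtLeast 5 α β
lemma3p12 = α₀ , β₀ , ((λ ()) , (λ ())) , ((λ ()) , (λ ())) , apart⇒distAtLeast5 α₀-β₀-apart
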